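{- Let $G$ be a finite simple graph whose vertex set can be partitioned into stable blocks $V_1,\dots,V_n$. Then $\sigma(G)=\min_{1\le i\le n}\sigma(G[V_i])$.
   Context: All graphs are finite, undirected and simple; $G[S]$ denotes the induced subgraph on $S$, $\Delta$ maximum degree, $\alpha$ independence number. For a graph $G=(V,E)$ with at least one edge, $\sigma(G)=\min\{\Delta(G[S]): S\subseteq V,\ |S|>\alpha(G)\}$; for an edgeless graph $\sigma=\infty$. For a nonempty proper subset $S\subsetneq V$, the border $\mathrm{bord}(S)$ is the set of vertices of $S$ adjacent in $G$ to at least one vertex of $V\setminus S$, the interior is $\mathrm{int}(S)=S\setminus\mathrm{bord}(S)$, and $S$ is a stable block if $\alpha(G[S])=\alpha(G[\mathrm{int}(S)])$. -}

module Defs where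

open import Data.Bool using (Bool; true; false; if_then_else_; _∧_; _∨_; not; T)
open import Data.Nat using (ℕ; zero; suc; _⊔_; _⊓_; _<ᵇ_)
open import Data.Fin using (Fin)
open import Data.Fin.Subset using (Subset; _∈_; _⊂_; Nonempty; ∣_∣; _∩_; ⊤)
open import Data.List using (List; []; _∷_; map; foldr; _++_; allFin)
open import Data.Bool.ListAction using (any; all)
open import Data.Vec using (Vec; []; _∷_; lookup; tabulate)
open import Data.Empty using (⊥)
open import Data.Product using (∃)
open import Relation.Binary.PropositionalEquality using (_≡_; _≢_)

record Graph (N : ℕ) : Set where
  field
    adj    : Fin N → Fin N → Bool
    sym    : ∀ u v → adj u v ≡ adj v u
    irrefl : ∀ v → adj v v ≡ false
open Graph public

_∈ᵇ_ : ∀ {N} → Fin N → Subset N → Bool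
v ∈ᵇ S = lookup S v

allSubsets : (N : ℕ) → List (Subset N)
allSubsets zero = [] ∷ []
allSubsets (suc N) = map (false ∷_) (allSubsets N) ++ map (true ∷_) (allSubsets N)

_⊆ᵇ_ : ∀ {N} → Subset N → Subset N → Bool
S ⊆ᵇ U = all (λ v → not (v ∈ᵇ S) ∨ (v ∈ᵇ U)) (allFin _)

-- Vertices of Fin N and everything below: G[S] is handled by restricting to S.

nbrs : ∀ {N} → Graph N → Fin N → Subset N
nbrs G v = tabulate (adj G v)

degIn : ∀ {N} → Graph N → Subset N → Fin N → ℕ
degIn G S v = ∣ S ∩ nbrs G v ∣

-- Δ(G[S]) (0 for empty S)
maxDeg : ∀ {N} → Graph N → Subset N → ℕ
maxDeg G S = foldr (λ v m → (if v ∈ᵇ S then degIn G S v else 0) ⊔ m) 0 (allFin _)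

hasEdge : ∀ {N} → Graph N → Subset N → Bool
hasEdge G S = any (λ u → any (λ v → (u ∈ᵇ S) ∧ (v ∈ᵇ S) ∧ adj G u v) (allFin _)) (allFin _)

independent : ∀ {N} → Graph N → Subset N → Bool
independent G S = not (hasEdge G S)

alpha : ∀ {N} → Graph N → Subset N → ℕ
alpha G U = foldr (λ S m → (if (S ⊆ᵇ U) ∧ independent G S then ∣ S ∣ else 0) ⊔ m) 0 (allSubsets _)

data ℕ∞ : Set where
  fin : ℕ → ℕ∞
  ∞   : ℕ∞

min∞ : ℕ∞ → ℕ∞ → ℕ∞
min∞ (fin a) (fin b) = fin (a ⊓ b)
min∞ (fin a) ∞ = fin a
min∞ ∞ y = y

-- σ(G[U]) = min { Δ(G[S]) : S ⊆ U, |S| > α(G[U]) }, and ∞ if G[U] is edgeless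
sigma : ∀ {N} → Graph N → Subset N → ℕ∞
sigma G U =
  if hasEdge G U
  then foldr (λ S m → if (S ⊆ᵇ U) ∧ (alpha G U <ᵇ ∣ S ∣) then min∞ (fin (maxDeg G S)) m else m)
             ∞ (allSubsets _)
  else ∞

bord : ∀ {N} → Graph N → Subset N → Subset N
bord G S = tabulate (λ v → (v ∈ᵇ S) ∧ any (λ w → not (w ∈ᵇ S) ∧ adj G v w) (allFin _))

int : ∀ {N} → Graph N → Subset N → Subset N
int G S = tabulate (λ v → (v ∈ᵇ S) ∧ not (v ∈ᵇ bord G S))

record StableBlock {N} (G : Graph N) (S : Subset N) : Set where
  field
    nonempty : Nonempty S
    proper   : S ⊂ ⊤
    alphaEq  : alpha G S ≡ alpha G (int G S)

record IsPartition {N n} (Vs : Fin n → Subset N) : Set where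
  field
    cover    : ∀ v → ∃ λ i → v ∈ Vs i
    disjoint : ∀ i j → i ≢ j → ∀ v → v ∈ Vs i → v ∈ Vs j → ⊥

-- min over i of f i (∞ for n = 0)
min∞Fin : ∀ {n} → (Fin n → ℕ∞) → ℕ∞
min∞Fin f = foldr (λ i m → min∞ (f i) m) ∞ (allFin _)

-- In a stable block Vⱼ a maximum independent set of the interior (the core of Vⱼ) is a
-- maximum independent set of G[Vⱼ] all of whose neighbours lie in Vⱼ. Cores of different
-- blocks are therefore non-adjacent, so their union is independent and α(G) ≥ Σⱼ α(G[Vⱼ]),
-- while |I ∩ Vⱼ| ≤ α(G[Vⱼ]) for every independent I. Hence a set S with |S| > α(G) has
-- |S ∩ Vⱼ| > α(G[Vⱼ]) for some j, and Δ(G[S ∩ Vⱼ]) ≤ Δ(G[S]) gives minᵢ σ(G[Vᵢ]) ≤ σ(G).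
-- Conversely, a set S ⊆ Vᵢ with |S| > α(G[Vᵢ]), padded with the cores of the other blocks,
-- has more than α(G) vertices, and the padding vertices are isolated in it, so its maximum
-- degree is that of G[S]; hence σ(G) ≤ σ(G[Vᵢ]).

module Submission where

open import Defs
open import Data.Nat using (ℕ)
open import Data.Fin using (Fin)
open import Data.Fin.Subset using (Subset; ⊤)
open import Relation.Binary.PropositionalEquality using (_≡_)

open import Data.Bool using (Bool; true; false; not; _∧_; _∨_; if_then_else_; T)
open import Data.Bool.Properties using (T-∧; T-≡; ∧-identityʳ; ∧-zeroʳ)
open import Data.Bool.ListAction using (any)
open import Data.Empty using (⊥-elim)
open import Data.Fin using (zero; suc; _≟_)
open import Data.Fin.Properties using (all?; ¬∀⟶∃¬; punchInᵢ≢i)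
open import Data.Fin.Subset using (_∈_; _∉_; _⊆_; _∩_; _∪_; ∁; ∣_∣; Empty; ⊥)
open import Data.Fin.Subset.Properties
  using (_∈?_; ∉⊥; ⊆⊤; x∈p∩q⁺; x∈p∩q⁻; p∩q⊆p; p∩q⊆q; x∈p∪q⁺; x∈p∪q⁻;
         x∈∁p⇒x∉p; x∉p⇒x∈∁p; p⊆q⇒∣p∣≤∣q∣; Empty-unique; ∣⊥∣≡0)
open import Data.List using (List; []; _∷_; foldr; allFin; map)
open import Data.List.Membership.Propositional using (lose) renaming (_∈_ to _∈ₗ_)
open import Data.List.Membership.Propositional.Properties using (∈-allFin; ∈-++⁺ˡ; ∈-++⁺ʳ; ∈-map⁺)
open import Data.List.Relation.Unary.All as All using ()
open import Data.List.Relation.Unary.All.Properties using (all⁺; all⁻)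
open import Data.List.Relation.Unary.Any using (here; there; satisfied)
open import Data.List.Relation.Unary.Any.Properties using (any⁺; any⁻)
open import Data.Nat using (zero; suc; _+_; _≤_; _<_; _<ᵇ_; _⊔_; z≤n; _≤?_)
open import Data.Nat.Properties
  using (+-0-commutativeMonoid; +-mono-≤; +-mono-<-≤; +-mono-≤-<; +-identityʳ;
         ≤-refl; ≤-trans; ≤-reflexive; ≤-antisym; <⇒≤; <⇒≱; ≰⇒>; <-≤-trans; ≤-<-trans;
         m≤m⊔n; m≤n⊔m; ⊔-lub; ⊔-sel; m⊓n≤m; m⊓n≤n; ⊓-glb; <ᵇ⇒<; <⇒<ᵇ; module ≤-Reasoning)
open import Algebra.Properties.CommutativeMonoid.Sum +-0-commutativeMonoid
  using (sum; sum-syntax; ∑-comm; sum-remove; sum-cong-≗; sum-replicate-zero)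
open import Data.Product using (∃; ∃₂; _×_; _,_; proj₁; proj₂)
open import Data.Sum using (_⊎_; inj₁; inj₂)
open import Data.Unit using (tt)
open import Data.Vec using ([]; _∷_; lookup; tabulate)
open import Data.Vec.Functional using (removeAt)
open import Data.Vec.Properties using (lookup∘tabulate; lookup-zipWith; []=⇒lookup; lookup⇒[]=)
open import Function using (_∘_; Equivalence)
open import Relation.Nullary using (¬_; yes; no; contradiction)
open import Relation.Binary.PropositionalEquality
  using (_≢_; refl; trans; cong; subst; module ≡-Reasoning)
import Relation.Binary.PropositionalEquality as ≡

private
  variable
    A : Set
    N n : ℕ
    a b : Bool
    x y : ℕ∞
    u v w : Fin N
    p q S U I : Subset N

T-not⁺ : ¬ T b → T (not b)
T-not⁺ {false} _ = tt
T-not⁺ {true} ¬t = ¬t tt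

T-not⁻ : T (not b) → ¬ T b
T-not⁻ {false} _ ()

T-⇒⁺ : (T a → T b) → T (not a ∨ b)
T-⇒⁺ {false} _ = tt
T-⇒⁺ {true} f = f tt

T-⇒⁻ : T (not a ∨ b) → T a → T b
T-⇒⁻ {true} t _ = t

T-∧⁺ : T a → T b → T (a ∧ b)
T-∧⁺ ta tb = Equivalence.from T-∧ (ta , tb)

T-∧⁻ : T (a ∧ b) → T a × T b
T-∧⁻ = Equivalence.to T-∧

if-T : ∀ {c : ℕ} → T b → (if b then c else 0) ≡ c
if-T {true} _ = refl

if-≤ : ∀ {c d : ℕ} → (T b → c ≤ d) → (if b then c else 0) ≤ d
if-≤ {true} h = h tt
if-≤ {false} _ = z≤n

∈⇒T : u ∈ p → T (u ∈ᵇ p)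
∈⇒T u∈p = Equivalence.from T-≡ ([]=⇒lookup u∈p)

T⇒∈ : T (u ∈ᵇ p) → u ∈ p
T⇒∈ {u = u} {p} t = lookup⇒[]= u p (Equivalence.to T-≡ t)

∈-tabulate⁺ : ∀ {f : Fin N → Bool} → T (f u) → u ∈ tabulate f
∈-tabulate⁺ {u = u} {f} t = T⇒∈ (subst T (≡.sym (lookup∘tabulate f u)) t)

∈-tabulate⁻ : ∀ {f : Fin N → Bool} → u ∈ tabulate f → T (f u)
∈-tabulate⁻ {u = u} {f} u∈ = subst T (lookup∘tabulate f u) (∈⇒T u∈)

∣Empty∣≡0 : Empty p → ∣ p ∣ ≡ 0
∣Empty∣≡0 {N} empty rewrite Empty-unique empty = ∣⊥∣≡0 N

⊆ᵇ-complete : p ⊆ q → T (p ⊆ᵇ q)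
⊆ᵇ-complete {p = p} {q} p⊆q = all⁻ (λ v → not (v ∈ᵇ p) ∨ (v ∈ᵇ q)) {xs = allFin _}
  (All.tabulate λ _ → T-⇒⁺ (∈⇒T ∘ p⊆q ∘ T⇒∈ {p = p}))

⊆ᵇ-sound : T (p ⊆ᵇ q) → p ⊆ q
⊆ᵇ-sound t {x} x∈p = T⇒∈ (T-⇒⁻ (All.lookup (all⁺ _ _ t) (∈-allFin x)) (∈⇒T x∈p))

∈-allSubsets : (p : Subset N) → p ∈ₗ allSubsets N
∈-allSubsets [] = here refl
∈-allSubsets (false ∷ p) = ∈-++⁺ˡ (∈-map⁺ (false ∷_) (∈-allSubsets p))
∈-allSubsets (true ∷ p) =
  ∈-++⁺ʳ (map (false ∷_) (allSubsets _)) (∈-map⁺ (true ∷_) (∈-allSubsets p))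

infix 4 _≤∞_

data _≤∞_ : ℕ∞ → ℕ∞ → Set where
  fin≤fin : ∀ {m k} → m ≤ k → fin m ≤∞ fin k
  ≤∞-top  : ∀ {x} → x ≤∞ ∞

≤∞-trans : x ≤∞ y → ∀ {z} → y ≤∞ z → x ≤∞ z
≤∞-trans (fin≤fin m≤k) (fin≤fin k≤l) = fin≤fin (≤-trans m≤k k≤l)
≤∞-trans _ ≤∞-top = ≤∞-top

≤∞-antisym : x ≤∞ y → y ≤∞ x → x ≡ y
≤∞-antisym (fin≤fin m≤k) (fin≤fin k≤m) = cong fin (≤-antisym m≤k k≤m)
≤∞-antisym ≤∞-top ≤∞-top = refl

≤∞-refl : x ≤∞ x
≤∞-refl {fin m} = fin≤fin ≤-refl
≤∞-refl {∞} = ≤∞-top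

min∞-≤ˡ : ∀ x y → min∞ x y ≤∞ x
min∞-≤ˡ (fin m) (fin k) = fin≤fin (m⊓n≤m m k)
min∞-≤ˡ (fin m) ∞ = ≤∞-refl
min∞-≤ˡ ∞ y = ≤∞-top

min∞-≤ʳ : ∀ x y → min∞ x y ≤∞ y
min∞-≤ʳ (fin m) (fin k) = fin≤fin (m⊓n≤n m k)
min∞-≤ʳ (fin m) ∞ = ≤∞-top
min∞-≤ʳ ∞ y = ≤∞-refl

min∞-glb : ∀ {z} → z ≤∞ x → z ≤∞ y → z ≤∞ min∞ x y
min∞-glb (fin≤fin m≤k) (fin≤fin m≤l) = fin≤fin (⊓-glb m≤k m≤l)
min∞-glb z≤x@(fin≤fin _) ≤∞-top = z≤x
min∞-glb ≤∞-top z≤y = z≤y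

-- Filtered maxima and minima over lists

-- The folds defining alpha, maxDeg, sigma and min∞Fin are instances of these up to unfolding.
module _ (c : A → Bool) where

  maxOver : (A → ℕ) → List A → ℕ
  maxOver f = foldr (λ x m → (if c x then f x else 0) ⊔ m) 0

  maxOver-upper : ∀ f {x xs} → x ∈ₗ xs → T (c x) → f x ≤ maxOver f xs
  maxOver-upper f {xs = x ∷ xs} (here refl) cx =
    ≤-trans (≤-reflexive (≡.sym (if-T cx))) (m≤m⊔n _ _)
  maxOver-upper f {xs = y ∷ xs} (there x∈xs) cx = ≤-trans (maxOver-upper f x∈xs cx) (m≤n⊔m _ _)

  maxOver-lub : ∀ f {k} xs → (∀ {x} → x ∈ₗ xs → T (c x) → f x ≤ k) → maxOver f xs ≤ k
  maxOver-lub f [] _ = z≤n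
  maxOver-lub f (x ∷ xs) h = ⊔-lub (if-≤ (h (here refl))) (maxOver-lub f xs (h ∘ there))

  maxOver-attained : ∀ f xs → maxOver f xs ≡ 0 ⊎ ∃ λ x → T (c x) × maxOver f xs ≡ f x
  maxOver-attained f [] = inj₁ refl
  maxOver-attained f (x ∷ xs) with ⊔-sel (if c x then f x else 0) (maxOver f xs)
  ... | inj₁ e with c x in cx
  ...   | true = inj₂ (x , Equivalence.from T-≡ cx , e)
  ...   | false = inj₁ e
  maxOver-attained f (x ∷ xs) | inj₂ e with maxOver-attained f xs
  ...   | inj₁ z = inj₁ (trans e z)
  ...   | inj₂ (y , cy , z) = inj₂ (y , cy , trans e z)

  minOver : (A → ℕ∞) → List A → ℕ∞
  minOver f = foldr (λ x m → if c x then min∞ (f x) m else m) ∞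

  minOver-lower : ∀ f {x xs} → x ∈ₗ xs → T (c x) → minOver f xs ≤∞ f x
  minOver-lower f {x} {_ ∷ xs} (here refl) cx with c x
  ... | true = min∞-≤ˡ (f x) (minOver f xs)
  minOver-lower f {x} {y ∷ xs} (there x∈xs) cx with c y
  ... | true = ≤∞-trans (min∞-≤ʳ (f y) (minOver f xs)) (minOver-lower f x∈xs cx)
  ... | false = minOver-lower f x∈xs cx

  minOver-glb : ∀ f xs → (∀ {x} → x ∈ₗ xs → T (c x) → y ≤∞ f x) → y ≤∞ minOver f xs
  minOver-glb f [] _ = ≤∞-top
  minOver-glb f (x ∷ xs) h with c x | h (here refl)
  ... | true | y≤fx = min∞-glb (y≤fx tt) (minOver-glb f xs (h ∘ there))
  ... | false | _ = minOver-glb f xs (h ∘ there)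

min∞Fin-lower : (f : Fin n → ℕ∞) (i : Fin n) → min∞Fin f ≤∞ f i
min∞Fin-lower f i = minOver-lower (λ _ → true) f (∈-allFin i) tt

min∞Fin-glb : {f : Fin n → ℕ∞} → (∀ i → y ≤∞ f i) → y ≤∞ min∞Fin f
min∞Fin-glb {f = f} h = minOver-glb (λ _ → true) f (allFin _) (λ {i} _ _ → h i)

-- Induced subgraphs: independence, α, Δ, σ and interiors

module _ (G : Graph N) where

  Independent : Subset N → Set
  Independent I = ∀ {u v} → u ∈ I → v ∈ I → ¬ T (adj G u v)

  Independent-⊆ : p ⊆ q → Independent q → Independent p
  Independent-⊆ p⊆q indep u∈p v∈p = indep (p⊆q u∈p) (p⊆q v∈p)

  edgeIn : Subset N → Fin N → Fin N → Bool
  edgeIn S u v = (u ∈ᵇ S) ∧ (v ∈ᵇ S) ∧ adj G u v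

  adj-sym : T (adj G u v) → T (adj G v u)
  adj-sym {u} {v} = subst T (Graph.sym G u v)

  hasEdge-complete : u ∈ S → v ∈ S → T (adj G u v) → T (hasEdge G S)
  hasEdge-complete {u} {S} {v} u∈S v∈S uv =
    any⁺ _ (lose (∈-allFin u) (any⁺ _ (lose (∈-allFin v) (T-∧⁺ (∈⇒T u∈S) (T-∧⁺ (∈⇒T v∈S) uv)))))

  hasEdge-sound : T (hasEdge G S) → ∃₂ λ u v → u ∈ S × v ∈ S × T (adj G u v)
  hasEdge-sound {S} t =
    let u , tu = satisfied (any⁻ (λ u → any (edgeIn S u) (allFin _)) (allFin _) t)
        v , tv = satisfied (any⁻ (edgeIn S u) (allFin _) tu)
        u∈S , rest = T-∧⁻ tv
        v∈S , uv = T-∧⁻ rest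
    in u , v , T⇒∈ u∈S , T⇒∈ v∈S , uv

  independent-sound : T (independent G I) → Independent I
  independent-sound t u∈I v∈I uv = T-not⁻ t (hasEdge-complete u∈I v∈I uv)

  independent-complete : Independent I → T (independent G I)
  independent-complete indep = T-not⁺ λ t →
    let _ , _ , u∈I , v∈I , uv = hasEdge-sound t in indep u∈I v∈I uv

  alpha-upper : I ⊆ U → Independent I → ∣ I ∣ ≤ alpha G U
  alpha-upper {I = I} I⊆U indep =
    maxOver-upper _ ∣_∣ (∈-allSubsets I) (T-∧⁺ (⊆ᵇ-complete I⊆U) (independent-complete indep))

  alpha-attained : (U : Subset N) → ∃ λ I → I ⊆ U × Independent I × ∣ I ∣ ≡ alpha G U
  alpha-attained U with maxOver-attained (λ S → (S ⊆ᵇ U) ∧ independent G S) ∣_∣ (allSubsets N)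
  ... | inj₁ α≡0 = ⊥ , ⊥-elim ∘ ∉⊥ , ⊥-elim ∘ ∉⊥ , trans (∣⊥∣≡0 N) (≡.sym α≡0)
  ... | inj₂ (I , cond , α≡∣I∣) =
    let I⊆U , indep = T-∧⁻ cond
    in I , ⊆ᵇ-sound I⊆U , independent-sound indep , ≡.sym α≡∣I∣

  ∣∩∣≤alpha : Independent I → ∣ I ∩ U ∣ ≤ alpha G U
  ∣∩∣≤alpha {I} {U} indep = alpha-upper (p∩q⊆q I U) (Independent-⊆ (p∩q⊆p I U) indep)

  degIn-≤ : (∀ {w} → w ∈ p → T (adj G v w) → w ∈ q) → degIn G p v ≤ degIn G q v
  degIn-≤ {p = p} h = p⊆q⇒∣p∣≤∣q∣ λ w∈ →
    let w∈p , w∈N = x∈p∩q⁻ p _ w∈ in x∈p∩q⁺ (h w∈p (∈-tabulate⁻ w∈N) , w∈N)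

  degIn-isolated : (∀ {w} → w ∈ p → ¬ T (adj G v w)) → degIn G p v ≡ 0
  degIn-isolated {p = p} h = ∣Empty∣≡0 λ (w , w∈) →
    let w∈p , w∈N = x∈p∩q⁻ p _ w∈ in h w∈p (∈-tabulate⁻ w∈N)

  degIn-≤-maxDeg : v ∈ S → degIn G S v ≤ maxDeg G S
  degIn-≤-maxDeg {v} {S} v∈S = maxOver-upper (_∈ᵇ S) (degIn G S) (∈-allFin v) (∈⇒T v∈S)

  maxDeg-lub : ∀ {k} → (∀ {v} → v ∈ S → degIn G S v ≤ k) → maxDeg G S ≤ k
  maxDeg-lub {S} h = maxOver-lub (_∈ᵇ S) (degIn G S) (allFin _) (λ _ → h ∘ T⇒∈)

  maxDeg-mono : p ⊆ q → maxDeg G p ≤ maxDeg G q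
  maxDeg-mono p⊆q = maxDeg-lub λ v∈p →
    ≤-trans (degIn-≤ (λ w∈p _ → p⊆q w∈p)) (degIn-≤-maxDeg (p⊆q v∈p))

  candidate : Subset N → Subset N → Bool
  candidate U S = (S ⊆ᵇ U) ∧ (alpha G U <ᵇ ∣ S ∣)

  sigma-upper : S ⊆ U → alpha G U < ∣ S ∣ → sigma G U ≤∞ fin (maxDeg G S)
  sigma-upper {S} {U} S⊆U α<∣S∣ with hasEdge G U in e
  ... | true = minOver-lower (candidate U) (fin ∘ maxDeg G) (∈-allSubsets S)
                 (T-∧⁺ (⊆ᵇ-complete S⊆U) (<⇒<ᵇ α<∣S∣))
  ... | false = ⊥-elim (<⇒≱ α<∣S∣ (alpha-upper S⊆U (Independent-⊆ S⊆U U-independent)))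
    where
    U-independent : Independent U
    U-independent = independent-sound (subst (T ∘ not) (≡.sym e) tt)

  sigma-glb : (∀ {S} → S ⊆ U → alpha G U < ∣ S ∣ → y ≤∞ fin (maxDeg G S)) → y ≤∞ sigma G U
  sigma-glb {U = U} h with hasEdge G U
  ... | true = minOver-glb (candidate U) (fin ∘ maxDeg G) (allSubsets _) λ {S} _ cond →
    let S⊆U , α<∣S∣ = T-∧⁻ cond in h (⊆ᵇ-sound {p = S} S⊆U) (<ᵇ⇒< _ _ α<∣S∣)
  ... | false = ≤∞-top

  int⊆ : int G S ⊆ S
  int⊆ v∈int = T⇒∈ (proj₁ (T-∧⁻ (∈-tabulate⁻ v∈int)))

  int-closed : v ∈ int G S → T (adj G v w) → w ∈ S
  int-closed {v} {S} {w} v∈int vw with w ∈? S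
  ... | yes w∈S = w∈S
  ... | no w∉S = contradiction v∈bord v∉bord
    where
    v∉bord : ¬ T (v ∈ᵇ bord G S)
    v∉bord = T-not⁻ (proj₂ (T-∧⁻ (∈-tabulate⁻ v∈int)))
    v∈bord : T (v ∈ᵇ bord G S)
    v∈bord = ∈⇒T {p = bord G S} (∈-tabulate⁺ (T-∧⁺ (∈⇒T (int⊆ {S = S} v∈int))
      (any⁺ _ (lose (∈-allFin w) (T-∧⁺ (T-not⁺ (w∉S ∘ T⇒∈ {p = S})) vw)))))

-- Counting along a partition

indicator : Bool → ℕ
indicator b = if b then 1 else 0

∣p∣≡∑indicator : (p : Subset N) → ∣ p ∣ ≡ ∑[ x < N ] indicator (x ∈ᵇ p)
∣p∣≡∑indicator [] = refl
∣p∣≡∑indicator (true ∷ p) = cong suc (∣p∣≡∑indicator p)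
∣p∣≡∑indicator (false ∷ p) = ∣p∣≡∑indicator p

sum-single : (f : Fin n → ℕ) (i : Fin n) → (∀ j → j ≢ i → f j ≡ 0) → sum f ≡ f i
sum-single {suc n} f i f≡0 = begin
  sum f                     ≡⟨ sum-remove {i = i} f ⟩
  f i + sum (removeAt f i)  ≡⟨ cong (f i +_) (sum-cong-≗ {n} (λ k → f≡0 _ (punchInᵢ≢i i k))) ⟩
  f i + ∑[ _ < n ] 0        ≡⟨ cong (f i +_) (sum-replicate-zero n) ⟩
  f i + 0                   ≡⟨ +-identityʳ (f i) ⟩
  f i                       ∎
  where open ≡-Reasoning

sum-mono-≤ : {f g : Fin n → ℕ} → (∀ i → f i ≤ g i) → sum f ≤ sum g
sum-mono-≤ {zero} _ = z≤n
sum-mono-≤ {suc n} f≤g = +-mono-≤ (f≤g zero) (sum-mono-≤ (f≤g ∘ suc))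

sum-mono-< : {f g : Fin n → ℕ} → (∀ i → f i ≤ g i) → ∀ i → f i < g i → sum f < sum g
sum-mono-< f≤g zero fi<gi = +-mono-<-≤ fi<gi (sum-mono-≤ (f≤g ∘ suc))
sum-mono-< f≤g (suc i) fi<gi = +-mono-≤-< (f≤g zero) (sum-mono-< (f≤g ∘ suc) i fi<gi)

module Partition {Vs : Fin n → Subset N} (P : IsPartition Vs) where

  block : Fin N → Fin n
  block v = proj₁ (IsPartition.cover P v)

  ∈-block : ∀ v → v ∈ Vs (block v)
  ∈-block v = proj₂ (IsPartition.cover P v)

  block-unique : ∀ {v j} → v ∈ Vs j → block v ≡ j
  block-unique {v} {j} v∈Vj with block v ≟ j
  ... | yes e = e
  ... | no ne = ⊥-elim (IsPartition.disjoint P _ _ ne v (∈-block v) v∈Vj)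

  ∈-Vs-block : ∀ {v j} → block v ≡ j → v ∈ Vs j
  ∈-Vs-block {v} refl = ∈-block v

  block-disjoint : ∀ {v i j} → v ∈ Vs i → v ∈ Vs j → i ≡ j
  block-disjoint v∈Vᵢ v∈Vⱼ = trans (≡.sym (block-unique v∈Vᵢ)) (block-unique v∈Vⱼ)

  ∣p∣≡∑blocks : ∀ p → ∣ p ∣ ≡ ∑[ j < n ] ∣ p ∩ Vs j ∣
  ∣p∣≡∑blocks p = begin
    ∣ p ∣                               ≡⟨ ∣p∣≡∑indicator p ⟩
    ∑[ v < N ] indicator (v ∈ᵇ p)        ≡⟨ sum-cong-≗ (≡.sym ∘ split) ⟩
    ∑[ v < N ] ∑[ j < n ] χ v j          ≡⟨ ∑-comm χ ⟩
    ∑[ j < n ] ∑[ v < N ] χ v j          ≡⟨ sum-cong-≗ (λ j → ≡.sym (∣p∣≡∑indicator (p ∩ Vs j))) ⟩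
    ∑[ j < n ] ∣ p ∩ Vs j ∣              ∎
    where
    open ≡-Reasoning
    χ : Fin N → Fin n → ℕ
    χ v j = indicator (v ∈ᵇ (p ∩ Vs j))
    lookup-∩ : ∀ v j → v ∈ᵇ (p ∩ Vs j) ≡ (v ∈ᵇ p) ∧ (v ∈ᵇ Vs j)
    lookup-∩ v j = lookup-zipWith _∧_ v p (Vs j)
    on-block : ∀ v → v ∈ᵇ (p ∩ Vs (block v)) ≡ v ∈ᵇ p
    on-block v rewrite lookup-∩ v (block v) | []=⇒lookup (∈-block v) = ∧-identityʳ (v ∈ᵇ p)
    off-block : ∀ v j → j ≢ block v → v ∈ᵇ (p ∩ Vs j) ≡ false
    off-block v j j≢ rewrite lookup-∩ v j with v ∈ᵇ Vs j in e
    ... | true = ⊥-elim (j≢ (≡.sym (block-unique (lookup⇒[]= v (Vs j) e))))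
    ... | false = ∧-zeroʳ (v ∈ᵇ p)
    split : ∀ v → ∑[ j < n ] χ v j ≡ indicator (v ∈ᵇ p)
    split v = trans (sum-single _ (block v) (λ j j≢ → cong indicator (off-block v j j≢)))
                    (cong indicator (on-block v))

  blockwise-≤ : (∀ j → ∣ p ∩ Vs j ∣ ≤ ∣ q ∩ Vs j ∣) → ∣ p ∣ ≤ ∣ q ∣
  blockwise-≤ {p = p} {q} h = begin
    ∣ p ∣                    ≡⟨ ∣p∣≡∑blocks p ⟩
    ∑[ j < n ] ∣ p ∩ Vs j ∣  ≤⟨ sum-mono-≤ h ⟩
    ∑[ j < n ] ∣ q ∩ Vs j ∣  ≡⟨ ∣p∣≡∑blocks q ⟨
    ∣ q ∣                    ∎
    where open ≤-Reasoning

  blockwise-< : (∀ j → ∣ p ∩ Vs j ∣ ≤ ∣ q ∩ Vs j ∣) →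
                ∀ i → ∣ p ∩ Vs i ∣ < ∣ q ∩ Vs i ∣ → ∣ p ∣ < ∣ q ∣
  blockwise-< {p = p} {q} h i pᵢ<qᵢ = begin-strict
    ∣ p ∣                    ≡⟨ ∣p∣≡∑blocks p ⟩
    ∑[ j < n ] ∣ p ∩ Vs j ∣  <⟨ sum-mono-< h i pᵢ<qᵢ ⟩
    ∑[ j < n ] ∣ q ∩ Vs j ∣  ≡⟨ ∣p∣≡∑blocks q ⟨
    ∣ q ∣                    ∎
    where open ≤-Reasoning

-- Partitions into stable blocks

module StableBlockPartition (G : Graph N) {Vs : Fin n → Subset N}
                            (P : IsPartition Vs) (stable : ∀ i → StableBlock G (Vs i)) where
  open Partition P

  core : Fin n → Subset N
  core j = proj₁ (alpha-attained G (int G (Vs j)))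

  core⊆int : ∀ j → core j ⊆ int G (Vs j)
  core⊆int j = proj₁ (proj₂ (alpha-attained G (int G (Vs j))))

  core-independent : ∀ j → Independent G (core j)
  core-independent j = proj₁ (proj₂ (proj₂ (alpha-attained G (int G (Vs j)))))

  ∣core∣≡alpha : ∀ j → ∣ core j ∣ ≡ alpha G (Vs j)
  ∣core∣≡alpha j = trans (proj₂ (proj₂ (proj₂ (alpha-attained G (int G (Vs j))))))
                         (≡.sym (StableBlock.alphaEq (stable j)))

  core⊆block : ∀ j → core j ⊆ Vs j
  core⊆block j = int⊆ G ∘ core⊆int j

  core-block : ∀ {v j} → v ∈ core j → block v ≡ j
  core-block {j = j} = block-unique ∘ core⊆block j

  cores : Subset N
  cores = tabulate (λ v → v ∈ᵇ core (block v))

  ∈-cores⁺ : ∀ {v j} → v ∈ core j → v ∈ cores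
  ∈-cores⁺ {v} v∈core =
    ∈-tabulate⁺ (∈⇒T (subst (λ k → v ∈ core k) (≡.sym (core-block v∈core)) v∈core))

  ∈-cores⁻ : v ∈ cores → v ∈ core (block v)
  ∈-cores⁻ {v} v∈cores = T⇒∈ {p = core (block v)} (∈-tabulate⁻ v∈cores)

  cores-closed : v ∈ cores → T (adj G v w) → block w ≡ block v
  cores-closed v∈cores vw = block-unique (int-closed G (core⊆int _ (∈-cores⁻ v∈cores)) vw)

  cores-independent : Independent G cores
  cores-independent {u} {v} u∈cores v∈cores uv = core-independent (block u) (∈-cores⁻ u∈cores)
    (subst (λ j → v ∈ core j) (cores-closed u∈cores uv) (∈-cores⁻ v∈cores)) uv

  alpha≤∣cores∩block∣ : ∀ j → alpha G (Vs j) ≤ ∣ cores ∩ Vs j ∣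
  alpha≤∣cores∩block∣ j = begin
    alpha G (Vs j)      ≡⟨ ∣core∣≡alpha j ⟨
    ∣ core j ∣          ≤⟨ p⊆q⇒∣p∣≤∣q∣ (λ v∈core → x∈p∩q⁺ (∈-cores⁺ v∈core , core⊆block j v∈core)) ⟩
    ∣ cores ∩ Vs j ∣    ∎
    where open ≤-Reasoning

  overfull-block : alpha G ⊤ < ∣ S ∣ → ∃ λ j → alpha G (Vs j) < ∣ S ∩ Vs j ∣
  overfull-block {S = S} α<∣S∣ with all? (λ j → ∣ S ∩ Vs j ∣ ≤? alpha G (Vs j))
  ... | yes fits = ⊥-elim (<⇒≱ α<∣S∣ (begin
    ∣ S ∣       ≤⟨ blockwise-≤ {p = S} {q = cores} S∩Vⱼ≤cores∩Vⱼ ⟩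
    ∣ cores ∣   ≤⟨ alpha-upper G ⊆⊤ cores-independent ⟩
    alpha G ⊤   ∎))
    where
    open ≤-Reasoning
    S∩Vⱼ≤cores∩Vⱼ : ∀ j → ∣ S ∩ Vs j ∣ ≤ ∣ cores ∩ Vs j ∣
    S∩Vⱼ≤cores∩Vⱼ j = ≤-trans (fits j) (alpha≤∣cores∩block∣ j)
  ... | no ¬fits =
    let j , ¬fit = ¬∀⟶∃¬ n _ (λ j → ∣ S ∩ Vs j ∣ ≤? alpha G (Vs j)) ¬fits in j , ≰⇒> ¬fit

  min≤sigma : min∞Fin (λ i → sigma G (Vs i)) ≤∞ sigma G ⊤
  min≤sigma = sigma-glb G {U = ⊤} λ {S} _ α<∣S∣ →
    let j , overfull = overfull-block {S = S} α<∣S∣ in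
    ≤∞-trans (min∞Fin-lower _ j) (≤∞-trans (sigma-upper G (p∩q⊆q S (Vs j)) overfull)
                                           (fin≤fin (maxDeg-mono G (p∩q⊆p S (Vs j)))))

  module Padding (i : Fin n) {S : Subset N} (S⊆Vᵢ : S ⊆ Vs i) where

    padded : Subset N
    padded = S ∪ (cores ∩ ∁ (Vs i))

    ∈-padded⁻ : v ∈ padded → v ∈ S ⊎ (v ∈ cores × v ∉ Vs i)
    ∈-padded⁻ v∈padded with x∈p∪q⁻ S _ v∈padded
    ... | inj₁ v∈S = inj₁ v∈S
    ... | inj₂ v∈rest =
      let v∈cores , v∈∁Vᵢ = x∈p∩q⁻ cores _ v∈rest in inj₂ (v∈cores , x∈∁p⇒x∉p v∈∁Vᵢ)

    S⊆padded∩Vᵢ : S ⊆ padded ∩ Vs i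
    S⊆padded∩Vᵢ v∈S = x∈p∩q⁺ (x∈p∪q⁺ (inj₁ v∈S) , S⊆Vᵢ v∈S)

    cores∩Vⱼ⊆padded∩Vⱼ : ∀ {j} → j ≢ i → cores ∩ Vs j ⊆ padded ∩ Vs j
    cores∩Vⱼ⊆padded∩Vⱼ j≢i v∈ =
      let v∈cores , v∈Vⱼ = x∈p∩q⁻ cores _ v∈
          v∉Vᵢ = λ v∈Vᵢ → j≢i (block-disjoint v∈Vⱼ v∈Vᵢ)
      in x∈p∩q⁺ (x∈p∪q⁺ (inj₂ (x∈p∩q⁺ (v∈cores , x∉p⇒x∈∁p v∉Vᵢ))) , v∈Vⱼ)

    alpha<∣padded∣ : alpha G (Vs i) < ∣ S ∣ → alpha G ⊤ < ∣ padded ∣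
    alpha<∣padded∣ α<∣S∣ with alpha-attained G ⊤
    ... | I , _ , I-independent , ∣I∣≡α = begin-strict
      alpha G ⊤     ≡⟨ ∣I∣≡α ⟨
      ∣ I ∣         <⟨ blockwise-< {p = I} {q = padded} bound i on-Vᵢ ⟩
      ∣ padded ∣    ∎
      where
      open ≤-Reasoning
      ∣S∣≤ : ∣ S ∣ ≤ ∣ padded ∩ Vs i ∣
      ∣S∣≤ = p⊆q⇒∣p∣≤∣q∣ S⊆padded∩Vᵢ
      on-Vᵢ : ∣ I ∩ Vs i ∣ < ∣ padded ∩ Vs i ∣
      on-Vᵢ = ≤-<-trans (∣∩∣≤alpha G I-independent) (<-≤-trans α<∣S∣ ∣S∣≤)
      bound : ∀ j → ∣ I ∩ Vs j ∣ ≤ ∣ padded ∩ Vs j ∣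
      bound j with j ≟ i
      ... | yes refl = ≤-trans (∣∩∣≤alpha G I-independent) (≤-trans (<⇒≤ α<∣S∣) ∣S∣≤)
      ... | no j≢i = ≤-trans (∣∩∣≤alpha G I-independent)
                       (≤-trans (alpha≤∣cores∩block∣ j) (p⊆q⇒∣p∣≤∣q∣ (cores∩Vⱼ⊆padded∩Vⱼ j≢i)))

    neighbour-in-S : v ∈ S → w ∈ padded → T (adj G v w) → w ∈ S
    neighbour-in-S v∈S w∈padded vw with ∈-padded⁻ w∈padded
    ... | inj₁ w∈S = w∈S
    ... | inj₂ (w∈cores , w∉Vᵢ) =
      ⊥-elim (w∉Vᵢ (∈-Vs-block (trans (≡.sym (cores-closed w∈cores (adj-sym G vw)))
                                      (block-unique (S⊆Vᵢ v∈S)))))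

    padding-isolated : v ∈ cores → v ∉ Vs i → w ∈ padded → ¬ T (adj G v w)
    padding-isolated v∈cores v∉Vᵢ w∈padded vw with ∈-padded⁻ w∈padded
    ... | inj₁ w∈S =
      v∉Vᵢ (∈-Vs-block (trans (≡.sym (cores-closed v∈cores vw)) (block-unique (S⊆Vᵢ w∈S))))
    ... | inj₂ (w∈cores , _) = cores-independent v∈cores w∈cores vw

    maxDeg-padded : maxDeg G padded ≤ maxDeg G S
    maxDeg-padded = maxDeg-lub G {S = padded} case
      where
      case : v ∈ padded → degIn G padded v ≤ maxDeg G S
      case v∈padded with ∈-padded⁻ v∈padded
      ... | inj₁ v∈S = ≤-trans (degIn-≤ G (neighbour-in-S v∈S)) (degIn-≤-maxDeg G v∈S)
      ... | inj₂ (v∈cores , v∉Vᵢ) =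
        ≤-trans (≤-reflexive (degIn-isolated G (padding-isolated v∈cores v∉Vᵢ))) z≤n

  sigma≤min : sigma G ⊤ ≤∞ min∞Fin (λ i → sigma G (Vs i))
  sigma≤min = min∞Fin-glb λ i → sigma-glb G {U = Vs i} λ S⊆Vᵢ α<∣S∣ →
    let open Padding i S⊆Vᵢ in
    ≤∞-trans (sigma-upper G {S = padded} ⊆⊤ (alpha<∣padded∣ α<∣S∣)) (fin≤fin maxDeg-padded)

theorem4p19 : ∀ {N n} (G : Graph N) (Vs : Fin n → Subset N) →
    IsPartition Vs → (∀ i → StableBlock G (Vs i)) →
    sigma G ⊤ ≡ min∞Fin (λ i → sigma G (Vs i))
theorem4p19 G Vs P stable = ≤∞-antisym sigma≤min min≤sigma
  where open StableBlockPartition G P stable
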